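{- Let $P_1,\dots,P_{t-1}\in\mathbb{Q}[y]$ be integer-valued polynomials with zero constant terms and let $\vec{P}(x,y)=(x,\ x+P_1(y),\ \dots,\ x+P_{t-1}(y))$. Then $\mathcal{P}_{i,j}\subseteq\mathcal{P}_{i+1,j+1}$ for all $i,j\in\mathbb{N}_+$.
   Context: For a vector $\vec{v}=(v_1,\dots,v_t)$ and $l\in\mathbb{N}$, $\binom{\vec{v}}{l}=(\binom{v_1}{l},\dots,\binom{v_t}{l})$. For an integral polynomial map $\vec{P}$ in variables $\mathbf{x}=(x_1,\dots,x_D)$ (here $D=2$), write $\binom{\vec{P}(\mathbf{x})}{l}=\sum_{\mathbf{a}\in\mathbb{N}^D}\vec{b}_{l,\mathbf{a}}\binom{\mathbf{x}}{\mathbf{a}}$ with $\vec{b}_{l,\mathbf{a}}\in\mathbb{Z}^t$, where $\binom{\mathbf{x}}{\mathbf{a}}=\prod_r\binom{x_r}{a_r}$ and $|\mathbf{a}|=a_1+\dots+a_D$. For $i,j\in\mathbb{N}_+$, $\mathcal{P}_{i,j}$ is the real span of all vectors $\vec{b}_{l,\mathbf{a}}$ with $1\leqslant l\leqslant i$ and $|\mathbf{a}|\geqslant j$.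
   Formalization: The spans $\mathcal{P}_{i,j}$ are taken over ℚ rather than over the reals: the vectors considered have rational entries and the linear combinations have rational coefficients. -}

module Defs where

open import Data.Nat using (ℕ; zero; suc; _≤_)
import Data.Nat as ℕ
open import Data.Integer using (ℤ; +_)
open import Data.Rational using (ℚ; _+_; _-_; _*_; _/_; 0ℚ; 1ℚ)
open import Data.Fin using (Fin; zero; suc)
open import Data.List using (List; []; _∷_; map; foldr)
open import Data.List.Relation.Unary.All using (All)
open import Data.Product using (Σ; _×_; _,_; ∃-syntax)
open import Relation.Binary.PropositionalEquality using (_≡_)

ℤ→ℚ : ℤ → ℚ
ℤ→ℚ z = z / 1

ℕ→ℚ : ℕ → ℚ
ℕ→ℚ n = (+ n) / 1

sumℚ : List ℚ → ℚ
sumℚ = foldr _+_ 0ℚ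

-- A polynomial in ℚ[y], given by its coefficient list (c₀, c₁, c₂, …) in the monomial basis.
Poly : Set
Poly = List ℚ

eval : Poly → ℚ → ℚ
eval []       y = 0ℚ
eval (c ∷ cs) y = c + y * eval cs y

IntegerValued : Poly → Set
IntegerValued p = (n : ℤ) → ∃[ m ] eval p (ℤ→ℚ n) ≡ ℤ→ℚ m

ZeroConst : Poly → Set
ZeroConst p = eval p 0ℚ ≡ 0ℚ

binom : ℚ → ℕ → ℚ
binom v zero    = 1ℚ
binom v (suc l) = binom v l * (v - ℕ→ℚ l) * ((+ 1) / suc l)

-- Components of P⃗(x,y) = (x, x+P₁(y), …, x+P_{t-1}(y)), here t = suc s
-- and the polynomials are Ps : Fin s → Poly.
component : {s : ℕ} → (Fin s → Poly) → Fin (suc s) → ℚ → ℚ → ℚ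
component Ps zero    x y = x
component Ps (suc k) x y = x + eval (Ps k) y

Δx : (ℕ → ℕ → ℚ) → ℕ → ℕ → ℚ
Δx f x y = f (suc x) y - f x y

Δy : (ℕ → ℕ → ℚ) → ℕ → ℕ → ℚ
Δy f x y = f x (suc y) - f x y

iter : {A : Set} → ℕ → (A → A) → A → A
iter zero    g a = a
iter (suc n) g a = g (iter n g a)

-- Coefficient of binom(x,a₁) binom(y,a₂) in the Newton (binomial-basis) expansion
-- of a polynomial function f : (Δx^{a₁} Δy^{a₂} f)(0,0).
newtonCoeff : (ℕ → ℕ → ℚ) → ℕ → ℕ → ℚ
newtonCoeff f a₁ a₂ = iter a₁ Δx (iter a₂ Δy f) 0 0

-- b⃗_{l,a} : the coefficient vector of binom(x,a₁)binom(y,a₂) in binom(P⃗(x,y), l).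
bvec : {s : ℕ} → (Fin s → Poly) → ℕ → ℕ → ℕ → Fin (suc s) → ℚ
bvec Ps l a₁ a₂ k =
  newtonCoeff (λ x y → binom (component Ps k (ℕ→ℚ x) (ℕ→ℚ y)) l) a₁ a₂

Admissible : ℕ → ℕ → ℕ × ℕ × ℕ → Set
Admissible i j (l , a₁ , a₂) = (1 ≤ l × l ≤ i) × j ≤ a₁ ℕ.+ a₂

InP : {s : ℕ} → (Fin s → Poly) → ℕ → ℕ → (Fin (suc s) → ℚ) → Set
InP {s} Ps i j v =
  Σ (List (ℚ × ℕ × ℕ × ℕ)) λ terms →
    All (λ { (c , l , a₁ , a₂) → Admissible i j (l , a₁ , a₂) }) terms ×
    ((k : Fin (suc s)) →
      v k ≡ sumℚ (map (λ { (c , l , a₁ , a₂) → c * bvec Ps l a₁ a₂ k }) terms))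

{-# OPTIONS --safe #-}
module Submission where

-- Every component of P⃗(x, y) has the form x + Q(y), so shifting x by one shifts every
-- component by one, and Pascal's rule gives Δx binom(P⃗, l + 1) = binom(P⃗, l). Since b⃗_{l,a}
-- is the iterated difference Δx^{a₁} Δy^{a₂} binom(P⃗, l) at the origin and Δx commutes with
-- Δy, this yields b⃗_{l,(a₁,a₂)} = b⃗_{l+1,(a₁+1,a₂)}: every generator of 𝒫_{i,j} is a
-- generator of 𝒫_{i+1,j+1}.

open import Defs
open import Data.Nat using (ℕ; suc; _≤_)
open import Data.Fin using (Fin)
open import Data.Rational using (ℚ)

open import Data.Nat using (zero; z≤n; s≤s)
open import Data.Integer using (+_)
import Data.Integer as ℤ
import Data.Integer.Tactic.RingSolver as ℤ-Solver
open import Data.Rational using (_+_; _-_; _*_; _/_; 0ℚ; 1ℚ; toℚᵘ; fromℚᵘ; _≟_)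
open import Data.Rational.Properties
  using ( toℚᵘ-fromℚᵘ; fromℚᵘ-toℚᵘ; fromℚᵘ-cong; toℚᵘ-homo-+; toℚᵘ-homo-*
        ; *-identityʳ; +-*-commutativeRing)
open import Data.Rational.Unnormalised using (mkℚᵘ; *≡*; 1ℚᵘ)
  renaming (_≃_ to _≃ᵘ_; _+_ to _+ᵘ_; _*_ to _*ᵘ_)
import Data.Rational.Unnormalised.Properties as ℚᵘ
open import Data.List using (map)
open import Data.List.Properties using (map-cong; map-∘)
open import Data.List.Relation.Unary.All.Properties using (gmap⁺)
open import Data.Product using (_×_; _,_; map₂)
open import Function using (_∘_)
open import Relation.Binary.PropositionalEquality
open import Relation.Nullary.Decidable using (dec⇒maybe)
open import Tactic.RingSolver using (solve-∀)
import Tactic.RingSolver.Core.AlmostCommutativeRing as ACR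

open ≡-Reasoning

ℚ-ring : ACR.AlmostCommutativeRing _ _
ℚ-ring = ACR.fromCommutativeRing +-*-commutativeRing (λ x → dec⇒maybe (0ℚ ≟ x))

fromℚᵘ-homo-+ : ∀ p q → fromℚᵘ (p +ᵘ q) ≡ fromℚᵘ p + fromℚᵘ q
fromℚᵘ-homo-+ p q = begin
  fromℚᵘ (p +ᵘ q)
    ≡⟨ fromℚᵘ-cong (ℚᵘ.+-cong (toℚᵘ-fromℚᵘ p) (toℚᵘ-fromℚᵘ q)) ⟨
  fromℚᵘ (toℚᵘ (fromℚᵘ p) +ᵘ toℚᵘ (fromℚᵘ q))
    ≡⟨ fromℚᵘ-cong (toℚᵘ-homo-+ (fromℚᵘ p) (fromℚᵘ q)) ⟨
  fromℚᵘ (toℚᵘ (fromℚᵘ p + fromℚᵘ q))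
    ≡⟨ fromℚᵘ-toℚᵘ (fromℚᵘ p + fromℚᵘ q) ⟩
  fromℚᵘ p + fromℚᵘ q
    ∎

fromℚᵘ-homo-* : ∀ p q → fromℚᵘ (p *ᵘ q) ≡ fromℚᵘ p * fromℚᵘ q
fromℚᵘ-homo-* p q = begin
  fromℚᵘ (p *ᵘ q)
    ≡⟨ fromℚᵘ-cong (ℚᵘ.*-cong (toℚᵘ-fromℚᵘ p) (toℚᵘ-fromℚᵘ q)) ⟨
  fromℚᵘ (toℚᵘ (fromℚᵘ p) *ᵘ toℚᵘ (fromℚᵘ q))
    ≡⟨ fromℚᵘ-cong (toℚᵘ-homo-* (fromℚᵘ p) (fromℚᵘ q)) ⟨
  fromℚᵘ (toℚᵘ (fromℚᵘ p * fromℚᵘ q))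
    ≡⟨ fromℚᵘ-toℚᵘ (fromℚᵘ p * fromℚᵘ q) ⟩
  fromℚᵘ p * fromℚᵘ q
    ∎

ℕ→ℚ-suc : ∀ n → ℕ→ℚ (suc n) ≡ ℕ→ℚ n + 1ℚ
ℕ→ℚ-suc n = trans (fromℚᵘ-cong unnormalised) (fromℚᵘ-homo-+ (mkℚᵘ (+ n) 0) 1ℚᵘ)
  where
  cross-multiplied : ∀ m →
    (ℤ.1ℤ ℤ.+ m) ℤ.* (ℤ.1ℤ ℤ.* ℤ.1ℤ) ≡ (m ℤ.* ℤ.1ℤ ℤ.+ ℤ.1ℤ ℤ.* ℤ.1ℤ) ℤ.* ℤ.1ℤ
  cross-multiplied = ℤ-Solver.solve-∀
  unnormalised : mkℚᵘ (+ suc n) 0 ≃ᵘ mkℚᵘ (+ n) 0 +ᵘ 1ℚᵘ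
  unnormalised = *≡* (cross-multiplied (+ n))

-- In ℚᵘ, 1/ mkℚᵘ (+ suc n) 0 reduces to mkℚᵘ (+ 1) n, the unnormalised form of + 1 / suc n.
ℕ→ℚ-suc-*-inverse : ∀ n → ℕ→ℚ (suc n) * (+ 1 / suc n) ≡ 1ℚ
ℕ→ℚ-suc-*-inverse n =
  trans (sym (fromℚᵘ-homo-* (mkℚᵘ (+ suc n) 0) (mkℚᵘ (+ 1) n)))
        (fromℚᵘ-cong (ℚᵘ.*-inverseʳ (mkℚᵘ (+ suc n) 0)))

binom-+1-absorb : ∀ v l → binom (v + 1ℚ) l * (v + 1ℚ - ℕ→ℚ l) ≡ binom v l * (v + 1ℚ)
binom-+1-absorb v zero = base v
  where
  base : ∀ v → 1ℚ * (v + 1ℚ - 0ℚ) ≡ 1ℚ * (v + 1ℚ)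
  base = solve-∀ ℚ-ring
binom-+1-absorb v (suc l) = begin
  binom (v + 1ℚ) l * (v + 1ℚ - L) * q * (v + 1ℚ - ℕ→ℚ (suc l))
    ≡⟨ cong (λ t → binom (v + 1ℚ) l * (v + 1ℚ - L) * q * (v + 1ℚ - t)) (ℕ→ℚ-suc l) ⟩
  binom (v + 1ℚ) l * (v + 1ℚ - L) * q * (v + 1ℚ - (L + 1ℚ))
    ≡⟨ regroup (binom (v + 1ℚ) l * (v + 1ℚ - L)) v L q ⟩
  binom (v + 1ℚ) l * (v + 1ℚ - L) * (q * (v - L))
    ≡⟨ cong (_* (q * (v - L))) (binom-+1-absorb v l) ⟩
  binom v l * (v + 1ℚ) * (q * (v - L))
    ≡⟨ swap (binom v l) v L q ⟩
  binom v l * (v - L) * q * (v + 1ℚ)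
    ∎
  where
  L q : ℚ
  L = ℕ→ℚ l
  q = + 1 / suc l
  regroup : ∀ B v L q → B * q * (v + 1ℚ - (L + 1ℚ)) ≡ B * (q * (v - L))
  regroup = solve-∀ ℚ-ring
  swap : ∀ B v L q → B * (v + 1ℚ) * (q * (v - L)) ≡ B * (v - L) * q * (v + 1ℚ)
  swap = solve-∀ ℚ-ring

binom-pascal : ∀ v l → binom (v + 1ℚ) (suc l) - binom v (suc l) ≡ binom v l
binom-pascal v l = begin
  binom (v + 1ℚ) l * (v + 1ℚ - L) * q - binom v l * (v - L) * q
    ≡⟨ cong (λ t → t * q - binom v l * (v - L) * q) (binom-+1-absorb v l) ⟩
  binom v l * (v + 1ℚ) * q - binom v l * (v - L) * q
    ≡⟨ factor (binom v l) v L q ⟩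
  binom v l * ((L + 1ℚ) * q)
    ≡⟨ cong (λ t → binom v l * (t * q)) (ℕ→ℚ-suc l) ⟨
  binom v l * (ℕ→ℚ (suc l) * q)
    ≡⟨ cong (binom v l *_) (ℕ→ℚ-suc-*-inverse l) ⟩
  binom v l * 1ℚ
    ≡⟨ *-identityʳ (binom v l) ⟩
  binom v l
    ∎
  where
  L q : ℚ
  L = ℕ→ℚ l
  q = + 1 / suc l
  factor : ∀ B v L q → B * (v + 1ℚ) * q - B * (v - L) * q ≡ B * ((L + 1ℚ) * q)
  factor = solve-∀ ℚ-ring

_≗₂_ : (ℕ → ℕ → ℚ) → (ℕ → ℕ → ℚ) → Set
F ≗₂ G = ∀ x y → F x y ≡ G x y

iter-Δx-cong : ∀ n {F G} → F ≗₂ G → iter n Δx F ≗₂ iter n Δx G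
iter-Δx-cong zero    F≗G = F≗G
iter-Δx-cong (suc n) F≗G x y =
  cong₂ _-_ (iter-Δx-cong n F≗G (suc x) y) (iter-Δx-cong n F≗G x y)

iter-Δy-Δx-comm : ∀ n F → iter n Δy (Δx F) ≗₂ Δx (iter n Δy F)
iter-Δy-Δx-comm zero    F x y = refl
iter-Δy-Δx-comm (suc n) F x y = begin
  Δy (iter n Δy (Δx F)) x y
    ≡⟨ cong₂ _-_ (iter-Δy-Δx-comm n F x (suc y)) (iter-Δy-Δx-comm n F x y) ⟩
  (G (suc x) (suc y) - G x (suc y)) - (G (suc x) y - G x y)
    ≡⟨ interchange (G (suc x) (suc y)) (G x (suc y)) (G (suc x) y) (G x y) ⟩
  (G (suc x) (suc y) - G (suc x) y) - (G x (suc y) - G x y)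
    ∎
  where
  G : ℕ → ℕ → ℚ
  G = iter n Δy F
  interchange : ∀ a b c d → (a - b) - (c - d) ≡ (a - c) - (b - d)
  interchange = solve-∀ ℚ-ring

iter-suc′ : ∀ {A : Set} n (g : A → A) a → iter n g (g a) ≡ iter (suc n) g a
iter-suc′ zero    g a = refl
iter-suc′ (suc n) g a = cong g (iter-suc′ n g a)

newtonCoeff-cong : ∀ {F G} → F ≗₂ G →
  ∀ a₁ a₂ → newtonCoeff F a₁ a₂ ≡ newtonCoeff G a₁ a₂
newtonCoeff-cong F≗G a₁ a₂ = iter-Δx-cong a₁ (iter-Δy-cong a₂ F≗G) 0 0
  where
  iter-Δy-cong : ∀ n {F G} → F ≗₂ G → iter n Δy F ≗₂ iter n Δy G
  iter-Δy-cong zero    F≗G = F≗G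
  iter-Δy-cong (suc n) F≗G x y =
    cong₂ _-_ (iter-Δy-cong n F≗G x (suc y)) (iter-Δy-cong n F≗G x y)

newtonCoeff-Δx : ∀ F a₁ a₂ → newtonCoeff (Δx F) a₁ a₂ ≡ newtonCoeff F (suc a₁) a₂
newtonCoeff-Δx F a₁ a₂ = begin
  iter a₁ Δx (iter a₂ Δy (Δx F)) 0 0
    ≡⟨ iter-Δx-cong a₁ (iter-Δy-Δx-comm a₂ F) 0 0 ⟩
  iter a₁ Δx (Δx (iter a₂ Δy F)) 0 0
    ≡⟨ cong (λ H → H 0 0) (iter-suc′ a₁ Δx (iter a₂ Δy F)) ⟩
  iter (suc a₁) Δx (iter a₂ Δy F) 0 0
    ∎

Δx-binom-suc : (f : ℚ → ℚ → ℚ) → (∀ X Y → f (X + 1ℚ) Y ≡ f X Y + 1ℚ) → ∀ l →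
  Δx (λ x y → binom (f (ℕ→ℚ x) (ℕ→ℚ y)) (suc l)) ≗₂ (λ x y → binom (f (ℕ→ℚ x) (ℕ→ℚ y)) l)
Δx-binom-suc f f-+1 l x y = begin
  binom (f (ℕ→ℚ (suc x)) Y) (suc l) - binom (f (ℕ→ℚ x) Y) (suc l)
    ≡⟨ cong (λ t → binom t (suc l) - binom (f (ℕ→ℚ x) Y) (suc l)) f-suc ⟩
  binom (f (ℕ→ℚ x) Y + 1ℚ) (suc l) - binom (f (ℕ→ℚ x) Y) (suc l)
    ≡⟨ binom-pascal (f (ℕ→ℚ x) Y) l ⟩
  binom (f (ℕ→ℚ x) Y) l
    ∎
  where
  Y : ℚ
  Y = ℕ→ℚ y
  f-suc : f (ℕ→ℚ (suc x)) Y ≡ f (ℕ→ℚ x) Y + 1ℚ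
  f-suc = trans (cong (λ X → f X Y) (ℕ→ℚ-suc x)) (f-+1 (ℕ→ℚ x) Y)

component-+1 : ∀ {s} (Ps : Fin s → Poly) k X Y →
  component Ps k (X + 1ℚ) Y ≡ component Ps k X Y + 1ℚ
component-+1 Ps Fin.zero    X Y = refl
component-+1 Ps (Fin.suc k) X Y = swap X (eval (Ps k) Y)
  where
  swap : ∀ a b → a + 1ℚ + b ≡ a + b + 1ℚ
  swap = solve-∀ ℚ-ring

generator : ∀ {s} → (Fin s → Poly) → ℕ × ℕ × ℕ → Fin (suc s) → ℚ
generator Ps (l , a₁ , a₂) = bvec Ps l a₁ a₂

generator-suc-suc : ∀ {s} (Ps : Fin s → Poly) l a₁ a₂ k →
  generator Ps (suc l , suc a₁ , a₂) k ≡ generator Ps (l , a₁ , a₂) k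
generator-suc-suc Ps l a₁ a₂ k = begin
  newtonCoeff (F (suc l)) (suc a₁) a₂
    ≡⟨ newtonCoeff-Δx (F (suc l)) a₁ a₂ ⟨
  newtonCoeff (Δx (F (suc l))) a₁ a₂
    ≡⟨ newtonCoeff-cong (Δx-binom-suc (component Ps k) (component-+1 Ps k) l) a₁ a₂ ⟩
  newtonCoeff (F l) a₁ a₂
    ∎
  where
  F : ℕ → ℕ → ℕ → ℚ
  F l x y = binom (component Ps k (ℕ→ℚ x) (ℕ→ℚ y)) l

InP-reindex : ∀ {s} (Ps : Fin s → Poly) {i j i′ j′} (σ : ℕ × ℕ × ℕ → ℕ × ℕ × ℕ) →
  (∀ g → Admissible i j g → Admissible i′ j′ (σ g)) →
  (∀ g k → generator Ps (σ g) k ≡ generator Ps g k) →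
  ∀ v → InP Ps i j v → InP Ps i′ j′ v
InP-reindex {s} Ps σ σ-admissible σ-generator v (terms , admissible , v≡) =
  map (map₂ σ) terms ,
  gmap⁺ (λ {(c , g)} → σ-admissible g) admissible ,
  λ k → begin
    v k
      ≡⟨ v≡ k ⟩
    sumℚ (map (term k) terms)
      ≡⟨ cong sumℚ (map-cong (λ (c , g) → cong (c *_) (sym (σ-generator g k))) terms) ⟩
    sumℚ (map (term k ∘ map₂ σ) terms)
      ≡⟨ cong sumℚ (map-∘ terms) ⟩
    sumℚ (map (term k) (map (map₂ σ) terms))
      ∎
  where
  term : Fin (suc s) → ℚ × ℕ × ℕ × ℕ → ℚ
  term k (c , g) = c * generator Ps g k

lemma3p8 : (s : ℕ) (Ps : Fin s → Poly) →
    ((k : Fin s) → IntegerValued (Ps k)) →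
    ((k : Fin s) → ZeroConst (Ps k)) →
    (i j : ℕ) → 1 ≤ i → 1 ≤ j →
    (v : Fin (suc s) → ℚ) → InP Ps i j v → InP Ps (suc i) (suc j) v
lemma3p8 s Ps _ _ i j _ _ = InP-reindex Ps shift shift-admissible shift-generator
  where
  shift : ℕ × ℕ × ℕ → ℕ × ℕ × ℕ
  shift (l , a₁ , a₂) = (suc l , suc a₁ , a₂)
  shift-generator : ∀ g k → generator Ps (shift g) k ≡ generator Ps g k
  shift-generator (l , a₁ , a₂) = generator-suc-suc Ps l a₁ a₂
  shift-admissible : ∀ g → Admissible i j g → Admissible (suc i) (suc j) (shift g)
  shift-admissible (l , a₁ , a₂) ((_ , l≤i) , j≤a) = (s≤s z≤n , s≤s l≤i) , s≤s j≤a
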